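{- Let $G=(V,E)$ be a finite graph. Then $v(G)$ equals the minimum $r\ge0$ such that there exist cliques $C_1,\dots,C_r\subseteq V$ of $G$ (repetitions allowed) such that every edge of $G$ is contained in exactly one $C_i$ and every vertex of $G$ belongs to at least two of these cliques.
   Context: A clique is a set of pairwise adjacent vertices (singletons allowed). A linear hypergraph is a pair $(P,\mathcal L)$ with $P$ a finite set of points and $\mathcal L$ a set of subsets of $P$ (lines), any two distinct points in at most one line, every line with at least two points; its intersection graph has vertex set $\mathcal L$, distinct lines adjacent iff they intersect. $v(G)$ is the minimum number of points of a linear hypergraph whose intersection graph is isomorphic to $G$. An edge $\{a,b\}$ is contained in $C_i$ if $a,b\in C_i$. -}

module Defs where

open import Data.Nat using (ℕ; _≤_)
open import Data.Fin using (Fin)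
open import Data.Fin.Subset using (Subset; _∈_)
open import Data.Product using (Σ; ∃; _×_)
open import Relation.Nullary using (¬_)
open import Relation.Binary using (Rel; Decidable; Symmetric; Irreflexive)
open import Relation.Binary.PropositionalEquality using (_≡_; _≢_)
open import Function.Bundles using (_⇔_)
open import Level using (0ℓ)

record Graph (n : ℕ) : Set₁ where
  field
    Adj   : Rel (Fin n) 0ℓ
    dec   : Decidable Adj
    sym   : Symmetric Adj
    irrefl : Irreflexive _≡_ Adj

open Graph public

-- A linear hypergraph on point set Fin m, whose lines are indexed by the
-- vertices of G, such that this indexing is an isomorphism between the
-- intersection graph of the hypergraph and G.
record LinearRep {n : ℕ} (G : Graph n) (m : ℕ) : Set where
  field
    line      : Fin n → Subset m
    -- lines are distinct subsets (so the map vertices → lines is a bijection onto 𝓛)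
    distinct  : ∀ i j → line i ≡ line j → i ≡ j
    twoPoints : ∀ i → Σ (Fin m) λ p → Σ (Fin m) λ q → p ≢ q × p ∈ line i × q ∈ line i
    linear    : ∀ p q → p ≢ q → ∀ i j →
                p ∈ line i → q ∈ line i → p ∈ line j → q ∈ line j → line i ≡ line j
    intersect : ∀ i j → i ≢ j → Adj G i j ⇔ (Σ (Fin m) λ p → p ∈ line i × p ∈ line j)

HasLinearRep : ∀ {n} → Graph n → ℕ → Set
HasLinearRep G m = LinearRep G m

IsClique : ∀ {n} → Graph n → Subset n → Set
IsClique G C = ∀ a b → a ∈ C → b ∈ C → a ≢ b → Adj G a b

record CliqueCover {n : ℕ} (G : Graph n) (r : ℕ) : Set where
  field
    clique      : Fin r → Subset n
    isClique    : ∀ k → IsClique G (clique k)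
    edgeExactly : ∀ a b → Adj G a b →
                  Σ (Fin r) λ k → (a ∈ clique k × b ∈ clique k) ×
                    (∀ k′ → a ∈ clique k′ → b ∈ clique k′ → k′ ≡ k)
    vertexTwice : ∀ a → Σ (Fin r) λ k → Σ (Fin r) λ k′ → k ≢ k′ × a ∈ clique k × a ∈ clique k′

IsMinimum : (ℕ → Set) → ℕ → Set
IsMinimum P k = P k × (∀ m → P m → k ≤ m)

{-# OPTIONS --safe #-}
module Submission where

-- Point-line incidence is symmetric: in a linear representation the lines through a point form a
-- clique, and in a clique cover the cliques containing a vertex form a line. Under this duality,
-- "two points lie on at most one line" becomes "every edge lies in exactly one clique" and "every
-- line has two points" becomes "every vertex lies in two cliques", so G has a representation on m
-- points iff it has a cover by m cliques. Hence both minima are the same, and this minimum exists: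
-- covers of a fixed size are finite objects, so their existence is decidable, and one cover always
-- exists: every edge as a clique of its own, plus every vertex twice as a singleton.

open import Defs hiding (sym)
open import Data.Empty using (⊥-elim)
open import Data.Fin using (Fin; zero; suc; _<_)
open import Data.Fin.Properties using (_≟_; _<?_; all?; any?; <-cmp; <-irrefl; <-asym; *↔×)
open import Data.Fin.Subset using (Subset; _∈_)
open import Data.Fin.Subset.Properties using (_∈?_; anySubset?)
open import Data.Nat as ℕ using (ℕ)
open import Data.Nat.Induction using (<-wellFounded)
open import Data.Nat.Properties using (anyUpTo?; ≮⇒≥)
open import Data.Product using (Σ; ∃; _×_; _,_)
open import Data.Product.Function.NonDependent.Propositional using (_×-↔_)
open import Data.Sum using (_⊎_; inj₁; inj₂)
open import Data.Vec using (Vec; []; _∷_; lookup; tabulate)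
open import Data.Vec.Properties using (lookup∘tabulate; []=⇒lookup; lookup⇒[]=)
open import Function using (_∘_; _↔_; _⇔_; Inverse; Equivalence; mk⇔)
open import Function.Construct.Composition using (_↔-∘_)
open import Function.Construct.Identity using (↔-id)
open import Induction.WellFounded using (Acc; acc)
open import Relation.Binary using (tri<; tri≈; tri>)
open import Relation.Binary.PropositionalEquality using (_≡_; _≢_; _≗_; refl; sym; trans; cong; subst)
open import Relation.Nullary using (Dec; yes; no; does; ¬?)
open import Relation.Nullary.Decidable as Dec using (map′; _×-dec_; _⊎-dec_; _→-dec_; dec-true)

module _ {n : ℕ} {P : Fin n → Set} (P? : ∀ x → Dec (P x)) where

  subsetOf : Subset n
  subsetOf = tabulate (does ∘ P?)

  ∈-subsetOf⁺ : ∀ {x} → P x → x ∈ subsetOf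
  ∈-subsetOf⁺ {x} Px = lookup⇒[]= x subsetOf (trans (lookup∘tabulate (does ∘ P?) x) (dec-true (P? x) Px))

  ∈-subsetOf⁻ : ∀ {x} → x ∈ subsetOf → P x
  ∈-subsetOf⁻ {x} x∈ with P? x | trans (sym (lookup∘tabulate (does ∘ P?) x)) ([]=⇒lookup x∈)
  ... | yes Px | _ = Px
  ... | no _   | ()

transpose : ∀ {m n} → (Fin n → Subset m) → Fin m → Subset n
transpose f p = subsetOf (λ i → p ∈? f i)

module _ {m n : ℕ} {f : Fin n → Subset m} {i : Fin n} {p : Fin m} where

  ∈-transpose⁺ : p ∈ f i → i ∈ transpose f p
  ∈-transpose⁺ = ∈-subsetOf⁺ (λ i → p ∈? f i)

  ∈-transpose⁻ : i ∈ transpose f p → p ∈ f i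
  ∈-transpose⁻ = ∈-subsetOf⁻ (λ i → p ∈? f i)

module _ {P : ℕ → Set} (P? : ∀ m → Dec (P m)) where

  minimum-below : ∀ {M} → Acc ℕ._<_ M → P M → ∃ (IsMinimum P)
  minimum-below {M} (acc smaller) PM with anyUpTo? P? M
  ... | yes (m , m<M , Pm) = minimum-below (smaller m<M) Pm
  ... | no ∄m<M = M , PM , λ m Pm → ≮⇒≥ (λ m<M → ∄m<M (m , m<M , Pm))

  minimum-exists : ∀ {M} → P M → ∃ (IsMinimum P)
  minimum-exists = minimum-below (<-wellFounded _)

Searchable : Set → Set₁
Searchable A = ∀ {P : A → Set} → (∀ a → Dec (P a)) → Dec (∃ P)

Vec-searchable : ∀ {A} → Searchable A → ∀ r → Searchable (Vec A r)
Vec-searchable A? ℕ.zero P? = map′ ([] ,_) (λ { ([] , P[]) → P[] }) (P? [])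
Vec-searchable A? (ℕ.suc r) P? =
  map′ (λ (a , v , Pav) → a ∷ v , Pav) (λ { (a ∷ v , Pav) → a , v , Pav })
       (A? λ a → Vec-searchable A? r (P? ∘ (a ∷_)))

-- A function is searched through its table, to which it is only pointwise equal.
Fin→-searchable : ∀ {A} → Searchable A → ∀ r {P : (Fin r → A) → Set} →
                  (∀ {f g} → f ≗ g → P f → P g) → (∀ f → Dec (P f)) → Dec (∃ P)
Fin→-searchable A? r resp P? =
  map′ (λ (v , Pv) → lookup v , Pv)
       (λ (f , Pf) → tabulate f , resp (sym ∘ lookup∘tabulate f) Pf)
       (Vec-searchable A? r (P? ∘ lookup))

module _ {n : ℕ} (G : Graph n) where

  module _ {m : ℕ} (L : LinearRep G m) where
    open LinearRep L

    common-point-unique : ∀ {i j p q} → i ≢ j →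
                          p ∈ line i → p ∈ line j → q ∈ line i → q ∈ line j → p ≡ q
    common-point-unique {i} {j} {p} {q} i≢j p∈i p∈j q∈i q∈j with p ≟ q
    ... | yes p≡q = p≡q
    ... | no p≢q  = ⊥-elim (i≢j (distinct i j (linear p q p≢q i j p∈i q∈i p∈j q∈j)))

    toCliqueCover : CliqueCover G m
    toCliqueCover = record
      { clique      = transpose line
      ; isClique    = λ p a b p∈a p∈b a≢b →
          Equivalence.from (intersect a b a≢b) (p , ∈-transpose⁻ p∈a , ∈-transpose⁻ p∈b)
      ; edgeExactly = λ a b ab →
          let a≢b = λ a≡b → irrefl G a≡b ab
              p , p∈a , p∈b = Equivalence.to (intersect a b a≢b) ab
          in p , (∈-transpose⁺ p∈a , ∈-transpose⁺ p∈b) , λ q q∈a q∈b →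
               common-point-unique a≢b (∈-transpose⁻ q∈a) (∈-transpose⁻ q∈b) p∈a p∈b
      ; vertexTwice = λ a →
          let p , q , p≢q , p∈a , q∈a = twoPoints a
          in p , q , p≢q , ∈-transpose⁺ p∈a , ∈-transpose⁺ q∈a
      }

  module _ {r : ℕ} (C : CliqueCover G r) where
    open CliqueCover C

    common-clique-unique : ∀ {a b k k′} → a ≢ b →
                           a ∈ clique k → b ∈ clique k → a ∈ clique k′ → b ∈ clique k′ → k ≡ k′
    common-clique-unique {a} {b} {k} {k′} a≢b a∈k b∈k a∈k′ b∈k′ =
      let _ , _ , unique = edgeExactly a b (isClique k a b a∈k b∈k a≢b)
      in trans (unique k a∈k b∈k) (sym (unique k′ a∈k′ b∈k′))

    toLinearRep : LinearRep G r
    toLinearRep = record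
      { line      = transpose clique
      ; distinct  = distinct
      ; twoPoints = λ a →
          let k , k′ , k≢k′ , a∈k , a∈k′ = vertexTwice a
          in k , k′ , k≢k′ , ∈-transpose⁺ a∈k , ∈-transpose⁺ a∈k′
      ; linear    = linear
      ; intersect = λ a b a≢b → mk⇔
          (λ ab → let k , (a∈k , b∈k) , _ = edgeExactly a b ab
                  in k , ∈-transpose⁺ a∈k , ∈-transpose⁺ b∈k)
          (λ (k , k∈a , k∈b) → isClique k a b (∈-transpose⁻ k∈a) (∈-transpose⁻ k∈b) a≢b)
      }
      where
      distinct : ∀ a b → transpose clique a ≡ transpose clique b → a ≡ b
      distinct a b lines≡ with a ≟ b
      ... | yes a≡b = a≡b
      ... | no a≢b  =
        let k , k′ , k≢k′ , a∈k , a∈k′ = vertexTwice a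
            b∈ : ∀ {k} → a ∈ clique k → b ∈ clique k
            b∈ a∈ = ∈-transpose⁻ (subst (_ ∈_) lines≡ (∈-transpose⁺ a∈))
        in ⊥-elim (k≢k′ (common-clique-unique a≢b a∈k (b∈ a∈k) a∈k′ (b∈ a∈k′)))

      linear : ∀ k k′ → k ≢ k′ → ∀ a b →
               k ∈ transpose clique a → k′ ∈ transpose clique a →
               k ∈ transpose clique b → k′ ∈ transpose clique b →
               transpose clique a ≡ transpose clique b
      linear k k′ k≢k′ a b k∈a k′∈a k∈b k′∈b with a ≟ b
      ... | yes refl = refl
      ... | no a≢b   = ⊥-elim (k≢k′ (common-clique-unique a≢b
              (∈-transpose⁻ k∈a) (∈-transpose⁻ k∈b) (∈-transpose⁻ k′∈a) (∈-transpose⁻ k′∈b)))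

  HasLinearRep⇔CliqueCover : ∀ m → HasLinearRep G m ⇔ CliqueCover G m
  HasLinearRep⇔CliqueCover _ = mk⇔ toCliqueCover toLinearRep

  module _ {I : Set} (C : I → Subset n) where

    EdgesCoveredOnce : Set
    EdgesCoveredOnce = ∀ a b → Adj G a b →
      Σ I λ k → (a ∈ C k × b ∈ C k) × (∀ k′ → a ∈ C k′ → b ∈ C k′ → k′ ≡ k)

    VerticesCoveredTwice : Set
    VerticesCoveredTwice = ∀ a → Σ I λ k → Σ I λ k′ → k ≢ k′ × a ∈ C k × a ∈ C k′

    IsCliqueCover : Set
    IsCliqueCover = (∀ k → IsClique G (C k)) × EdgesCoveredOnce × VerticesCoveredTwice

  ∃IsCliqueCover⇔CliqueCover : ∀ r → ∃ (IsCliqueCover {Fin r}) ⇔ CliqueCover G r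
  ∃IsCliqueCover⇔CliqueCover _ = mk⇔
    (λ (C , cliques , once , twice) → record
      { clique = C ; isClique = cliques ; edgeExactly = once ; vertexTwice = twice })
    (λ C → let open CliqueCover C in clique , isClique , edgeExactly , vertexTwice)

  module _ {I J : Set} (e : J ↔ I) {C : I → Subset n} {D : J → Subset n}
           (D≗C∘to : ∀ k → D k ≡ C (Inverse.to e k)) where
    open Inverse e

    IsCliqueCover-transport : IsCliqueCover C → IsCliqueCover D
    IsCliqueCover-transport (cliques , once , twice) =
        (λ k a b a∈ b∈ → cliques (to k) a b (∈D⁻ a∈) (∈D⁻ b∈))
      , (λ a b ab → let k , (a∈ , b∈) , unique = once a b ab in
          from k , (∈D⁺ a∈ , ∈D⁺ b∈) , λ k′ a∈′ b∈′ →
            sym (inverseʳ (sym (unique (to k′) (∈D⁻ a∈′) (∈D⁻ b∈′)))))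
      , (λ a → let k , k′ , k≢k′ , a∈k , a∈k′ = twice a in
          from k , from k′ , (λ eq → k≢k′ (trans (sym (strictlyInverseˡ k)) (inverseˡ eq)))
                 , ∈D⁺ a∈k , ∈D⁺ a∈k′)
      where
      ∈D⁻ : ∀ {x k} → x ∈ D k → x ∈ C (to k)
      ∈D⁻ {x} {k} = subst (x ∈_) (D≗C∘to k)

      ∈D⁺ : ∀ {x i} → x ∈ C i → x ∈ D (from i)
      ∈D⁺ {x} {i} = subst (x ∈_) (sym (trans (D≗C∘to (from i)) (cong C (strictlyInverseˡ i))))

  isClique? : ∀ C → Dec (IsClique G C)
  isClique? C = all? λ a → all? λ b → a ∈? C →-dec b ∈? C →-dec ¬? (a ≟ b) →-dec dec G a b

  isCliqueCover? : ∀ {r} (C : Fin r → Subset n) → Dec (IsCliqueCover C)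
  isCliqueCover? C = all? (isClique? ∘ C) ×-dec edgesCoveredOnce? ×-dec verticesCoveredTwice?
    where
    edgesCoveredOnce? : Dec (EdgesCoveredOnce C)
    edgesCoveredOnce? = all? λ a → all? λ b → dec G a b →-dec any? λ k →
      (a ∈? C k ×-dec b ∈? C k) ×-dec all? λ k′ → a ∈? C k′ →-dec b ∈? C k′ →-dec k′ ≟ k

    verticesCoveredTwice? : Dec (VerticesCoveredTwice C)
    verticesCoveredTwice? = all? λ a → any? λ k → any? λ k′ →
      ¬? (k ≟ k′) ×-dec a ∈? C k ×-dec a ∈? C k′

  cliqueCover? : ∀ r → Dec (CliqueCover G r)
  cliqueCover? r = Dec.map (∃IsCliqueCover⇔CliqueCover r)
    (Fin→-searchable anySubset? r (λ f≗g → IsCliqueCover-transport (↔-id _) (sym ∘ f≗g)) isCliqueCover?)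

  -- Every vertex a owns the singleton slots (a , a , 0) and (a , a , 1), every edge a < b owns
  -- the slot (a , b , 0) holding {a , b}, and all remaining slots (a , _ , _) hold {a}.
  Slot : Set
  Slot = Fin n × Fin n × Fin 2

  EdgeSlot : Slot → Set
  EdgeSlot (a , b , c) = a < b × Adj G a b × c ≡ zero

  edgeSlot? : ∀ s → Dec (EdgeSlot s)
  edgeSlot? (a , b , c) = a <? b ×-dec dec G a b ×-dec c ≟ zero

  SlotMember : Slot → Fin n → Set
  SlotMember s@(a , b , _) x = x ≡ a ⊎ (EdgeSlot s × x ≡ b)

  slotMember? : ∀ s x → Dec (SlotMember s x)
  slotMember? s@(a , b , _) x = x ≟ a ⊎-dec (edgeSlot? s ×-dec x ≟ b)

  slotClique : Slot → Subset n
  slotClique s = subsetOf (slotMember? s)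

  ∈-slotClique⁺ : ∀ s {x} → SlotMember s x → x ∈ slotClique s
  ∈-slotClique⁺ s = ∈-subsetOf⁺ (slotMember? s)

  ∈-slotClique⁻ : ∀ s {x} → x ∈ slotClique s → SlotMember s x
  ∈-slotClique⁻ s = ∈-subsetOf⁻ (slotMember? s)

  slotClique-isClique : ∀ s → IsClique G (slotClique s)
  slotClique-isClique s@(_ , _ , _) x y x∈ y∈ x≢y with ∈-slotClique⁻ s x∈ | ∈-slotClique⁻ s y∈
  ... | inj₁ refl                  | inj₁ refl                  = ⊥-elim (x≢y refl)
  ... | inj₁ refl                  | inj₂ ((_ , ab , _) , refl) = ab
  ... | inj₂ ((_ , ab , _) , refl) | inj₁ refl                  = Graph.sym G ab
  ... | inj₂ (_ , refl)            | inj₂ (_ , refl)            = ⊥-elim (x≢y refl)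

  slotClique-unique : ∀ {x y} s → x < y → x ∈ slotClique s → y ∈ slotClique s → s ≡ (x , y , zero)
  slotClique-unique s@(_ , _ , _) x<y x∈ y∈ with ∈-slotClique⁻ s x∈ | ∈-slotClique⁻ s y∈
  ... | inj₁ refl                | inj₁ refl                    = ⊥-elim (<-irrefl refl x<y)
  ... | inj₁ refl                | inj₂ ((_ , _ , refl) , refl) = refl
  ... | inj₂ ((a<b , _) , refl)  | inj₁ refl                    = ⊥-elim (<-asym x<y a<b)
  ... | inj₂ (_ , refl)          | inj₂ (_ , refl)              = ⊥-elim (<-irrefl refl x<y)

  slotCover : IsCliqueCover slotClique
  slotCover = slotClique-isClique , once , twice
    where
    once-ordered : ∀ a b → a < b → Adj G a b →
      Σ Slot λ s → (a ∈ slotClique s × b ∈ slotClique s) ×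
                   (∀ s′ → a ∈ slotClique s′ → b ∈ slotClique s′ → s′ ≡ s)
    once-ordered a b a<b ab =
      s , (∈-slotClique⁺ s (inj₁ refl) , ∈-slotClique⁺ s (inj₂ ((a<b , ab , refl) , refl)))
        , λ s′ → slotClique-unique s′ a<b
      where s = (a , b , zero)

    once : EdgesCoveredOnce slotClique
    once a b ab with <-cmp a b
    ... | tri< a<b _ _ = once-ordered a b a<b ab
    ... | tri≈ _ a≡b _ = ⊥-elim (irrefl G a≡b ab)
    ... | tri> _ _ b<a =
      let s , (b∈ , a∈) , unique = once-ordered b a b<a (Graph.sym G ab)
      in s , (a∈ , b∈) , λ s′ a∈′ b∈′ → unique s′ b∈′ a∈′

    twice : VerticesCoveredTwice slotClique
    twice a = (a , a , zero) , (a , a , suc zero) , (λ ())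
            , ∈-slotClique⁺ (a , a , zero) (inj₁ refl) , ∈-slotClique⁺ (a , a , suc zero) (inj₁ refl)

  slotCliqueCover : CliqueCover G (n ℕ.* (n ℕ.* 2))
  slotCliqueCover = Equivalence.to (∃IsCliqueCover⇔CliqueCover _)
    (slotClique ∘ Inverse.to e , IsCliqueCover-transport e (λ _ → refl) slotCover)
    where
    e : Fin (n ℕ.* (n ℕ.* 2)) ↔ Slot
    e = (↔-id (Fin n) ×-↔ *↔× {n} {2}) ↔-∘ *↔× {n} {n ℕ.* 2}

mainTheorem7 : ∀ (n : ℕ) (G : Graph n) →
    Σ ℕ λ k → IsMinimum (HasLinearRep G) k × IsMinimum (CliqueCover G) k
mainTheorem7 n G =
  let k , cover , least = minimum-exists (cliqueCover? G) (slotCliqueCover G)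
      rep⇔cover = HasLinearRep⇔CliqueCover G
  in k , (Equivalence.from (rep⇔cover k) cover , λ m rep → least m (Equivalence.to (rep⇔cover m) rep))
       , cover , least
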